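{- Let $\mathbf c\colon\mathbb{N}\times\mathbb{N}\to\mathbb{Q}^+$ be a cost function such that $\mathbf c(x,s)\ge 2^{ -x}$ for all $x,s$. Then no Martin-Löf random $\Delta^0_2$ set $Z$ obeys $\mathbf c$.
   Context: A cost function is a computable function $\mathbf c\colon\mathbb{N}\times\mathbb{N}\to\mathbb{Q}^+$ that is nondecreasing in $s$ and nonincreasing in $x$. A computable approximation of a set $A\subseteq\mathbb{N}$ is a computable sequence of finite sets $(A_s)_{s\in\mathbb{N}}$ with $A(x)=\lim_s A_s(x)$ for every $x$. Given such an approximation, at each stage $s>0$ at which $A_s\neq A_{s-1}$, let $x$ be least with $A_s(x)\neq A_{s-1}(x)$; the cost incurred at stage $s$ is $\mathbf c(x,s)$. A $\Delta^0_2$ set $A$ obeys $\mathbf c$ if it has a computable approximation for which the total cost incurred over all stages is finite. A set $Z\subseteq\mathbb{N}$ is Martin-Löf random if for every computable sequence $(\sigma_i)_{i\in\mathbb{N}}$ of binary strings with $\sum_i 2^{ -|\sigma_i|}<\infty$, only finitely many $\sigma_i$ are initial segments of $Z$. -}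

module Defs where

open import Data.Nat as ℕ using (ℕ; zero; suc; _+_; _*_; _∸_; _^_; _/_; _%_)
open import Data.Integer as ℤ using (ℤ; +_; -[1+_])
open import Data.Rational as ℚ using (ℚ; ↥_; ↧ₙ_; 0ℚ; 1ℚ; ½)
open import Data.Bool using (Bool; true; false; if_then_else_)
open import Data.Fin using (Fin)
open import Data.Vec using (Vec; []; _∷_; lookup; map)
open import Data.List using (List; []; _∷_; length)
open import Data.Maybe using (Maybe; just; nothing)
open import Data.Product using (Σ; _×_; _,_; ∃)
open import Data.Unit using (⊤)
open import Data.Empty using (⊥)
open import Relation.Nullary using (¬_)
open import Relation.Binary.PropositionalEquality using (_≡_; _≢_)

data PR : ℕ → Set where
  zer  : ∀ {n} → PR n
  succ : PR 1
  proj : ∀ {n} → Fin n → PR n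
  comp : ∀ {m n} → PR m → Vec (PR n) m → PR n
  rec  : ∀ {n} → PR n → PR (suc (suc n)) → PR (suc n)
  mu   : ∀ {n} → PR (suc n) → PR n

mutual
  data Eval : ∀ {n} → PR n → Vec ℕ n → ℕ → Set where
    ev-zer  : ∀ {n} {xs : Vec ℕ n} → Eval zer xs 0
    ev-succ : ∀ {x} → Eval succ (x ∷ []) (suc x)
    ev-proj : ∀ {n} {xs : Vec ℕ n} (i : Fin n) → Eval (proj i) xs (lookup xs i)
    ev-comp : ∀ {m n} {f : PR m} {gs : Vec (PR n) m} {xs : Vec ℕ n} {ys : Vec ℕ m} {y} →
              EvalAll gs xs ys → Eval f ys y → Eval (comp f gs) xs y
    ev-rec0 : ∀ {n} {g : PR n} {h : PR (suc (suc n))} {xs : Vec ℕ n} {y} →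
              Eval g xs y → Eval (rec g h) (0 ∷ xs) y
    ev-recS : ∀ {n} {g : PR n} {h : PR (suc (suc n))} {xs : Vec ℕ n} {k r y} →
              Eval (rec g h) (k ∷ xs) r → Eval h (k ∷ r ∷ xs) y →
              Eval (rec g h) (suc k ∷ xs) y
    ev-mu   : ∀ {n} {f : PR (suc n)} {xs : Vec ℕ n} {y} →
              Eval f (y ∷ xs) 0 →
              (∀ z → z ℕ.< y → Σ ℕ (λ k → Eval f (z ∷ xs) (suc k))) →
              Eval (mu f) xs y

  data EvalAll : ∀ {m n} → Vec (PR n) m → Vec ℕ n → Vec ℕ m → Set where
    ev-[] : ∀ {n} {xs : Vec ℕ n} → EvalAll [] xs []
    ev-∷  : ∀ {m n} {g : PR n} {gs : Vec (PR n) m} {xs : Vec ℕ n} {y ys} →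
            Eval g xs y → EvalAll gs xs ys → EvalAll (g ∷ gs) xs (y ∷ ys)

Computable₁ : (ℕ → ℕ) → Set
Computable₁ f = Σ (PR 1) λ e → ∀ x → Eval e (x ∷ []) (f x)

Computable₂ : (ℕ → ℕ → ℕ) → Set
Computable₂ f = Σ (PR 2) λ e → ∀ x y → Eval e (x ∷ y ∷ []) (f x y)

encℤ : ℤ → ℕ
encℤ (+ n)     = 2 * n
encℤ -[1+ n ]  = suc (2 * n)

encStr : List Bool → ℕ
encStr []           = 0
encStr (false ∷ w)  = 1 + 2 * encStr w
encStr (true ∷ w)   = 2 + 2 * encStr w

Computableℚ₂ : (ℕ → ℕ → ℚ) → Set
Computableℚ₂ c = Computable₂ (λ x s → encℤ (↥ c x s)) × Computable₂ (λ x s → ↧ₙ c x s)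

ComputableStrSeq : (ℕ → List Bool) → Set
ComputableStrSeq σ = Computable₁ (λ i → encStr (σ i))

-- Finite sets of naturals via canonical indices: x ∈ D_n iff bit x of n is 1.
bit : ℕ → ℕ → Bool
bit n zero    with n % 2
... | 0 = false
... | _ = true
bit n (suc x) = bit (n / 2) x

2^-_ : ℕ → ℚ
2^- zero    = 1ℚ
2^- (suc k) = ½ ℚ.* (2^- k)

record IsCostFunction (c : ℕ → ℕ → ℚ) : Set where
  field
    computable    : Computableℚ₂ c
    positive      : ∀ x s → 0ℚ ℚ.< c x s
    nondecr-stage : ∀ x s t → s ℕ.≤ t → c x s ℚ.≤ c x t
    nonincr-arg   : ∀ x y s → x ℕ.≤ y → c y s ℚ.≤ c x s

IsApprox : (ℕ → ℕ) → (ℕ → Bool) → Set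
IsApprox g Z = Computable₁ g ×
  (∀ x → Σ ℕ λ s₀ → ∀ s → s₀ ℕ.≤ s → bit (g s) x ≡ Z x)

Δ⁰₂ : (ℕ → Bool) → Set
Δ⁰₂ Z = Σ (ℕ → ℕ) λ g → IsApprox g Z

search : ℕ → (ℕ → Bool) → Maybe ℕ
search zero    p = nothing
search (suc b) p with p 0
... | true  = just 0
... | false with search b (λ x → p (suc x))
...   | just x  = just (suc x)
...   | nothing = nothing

differ : Bool → Bool → Bool
differ true  false = true
differ false true  = true
differ _     _     = false

-- least x with x ∈ D_a ⇎ x ∈ D_b (if any); such x satisfies x < a + b + 1
firstDiff : ℕ → ℕ → Maybe ℕ
firstDiff a b = search (suc (a + b)) (λ x → differ (bit a x) (bit b x))

stageCost : (ℕ → ℕ → ℚ) → (ℕ → ℕ) → ℕ → ℚ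
stageCost c g s with firstDiff (g s) (g (s ∸ 1))
... | nothing = 0ℚ
... | just x  = c x s

costUpTo : (ℕ → ℕ → ℚ) → (ℕ → ℕ) → ℕ → ℚ
costUpTo c g zero    = 0ℚ
costUpTo c g (suc n) = costUpTo c g n ℚ.+ stageCost c g (suc n)

Obeys : (ℕ → Bool) → (ℕ → ℕ → ℚ) → Set
Obeys Z c = Σ (ℕ → ℕ) λ g → IsApprox g Z ×
  Σ ℚ λ B → ∀ n → costUpTo c g n ℚ.≤ B

IsPrefix : List Bool → (ℕ → Bool) → Set
IsPrefix []      Z = ⊤
IsPrefix (b ∷ w) Z = (b ≡ Z 0) × IsPrefix w (λ x → Z (suc x))

weightUpTo : (ℕ → List Bool) → ℕ → ℚ
weightUpTo σ zero    = 0ℚ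
weightUpTo σ (suc n) = weightUpTo σ n ℚ.+ 2^- (length (σ n))

MLRandom : (ℕ → Bool) → Set
MLRandom Z = (σ : ℕ → List Bool) → ComputableStrSeq σ →
  (Σ ℚ λ B → ∀ n → weightUpTo σ n ℚ.≤ B) →
  Σ ℕ λ N → ∀ i → N ℕ.≤ i → ¬ IsPrefix (σ i) Z

module Submission where

-- Suppose g is a computable approximation A_s = D_{g s}
-- of Z with total cost at most B.  Let Y s be the position where A_s first differs
-- from A_{s-1} (a position ≥ s if they are equal) and σ s the string of the first
-- Y s + 1 digits of A_s.  A change at x makes Y s = x, so σ s has weight
-- 2⁻⁽ˣ⁺¹⁾ ≤ 2⁻ˣ ≤ c(x, s); a stage without change contributes at most 2⁻⁽ˢ⁺¹⁾,
-- so the weight of σ is at most B + 1.  As σ is computable, randomness makes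
-- σ s a non-prefix of Z from some stage t on.  Yet once the first Y t + 1 digits have settled at a stage u, the
-- last stage i ∈ [t, u] that changes one of these digits has σ i a prefix of Z.

open import Defs

module Programs where

  open import Data.Nat using (ℕ; zero; suc; _+_; _*_; _∸_; _^_; _<_)
  open import Data.Nat.Properties using (+-comm; ∸-+-assoc)
  open import Data.Fin using (Fin; #_)
  open import Data.Vec using (Vec; []; _∷_; lookup; head; tail; map)
  open import Data.Vec.Relation.Unary.All using (All; []; _∷_)
  open import Data.Product using (Σ; _,_)
  open import Data.Empty using (⊥-elim)
  open import Relation.Binary.PropositionalEquality using (_≡_; _≢_; refl; sym; trans; cong; subst)

  record Comp (n : ℕ) (f : Vec ℕ n → ℕ) : Set where
    constructor computedBy
    field
      program : PR n
      correct : ∀ xs → Eval program xs (f xs)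
  open Comp public

  toComputable₁ : ∀ {f : ℕ → ℕ} → Comp 1 (λ v → f (head v)) → Computable₁ f
  toComputable₁ (computedBy P p) = P , λ x → p (x ∷ [])

  fromComputable₁ : ∀ {f : ℕ → ℕ} → Computable₁ f → Comp 1 (λ v → f (head v))
  fromComputable₁ (P , p) = computedBy P λ { (x ∷ []) → p x }

  respects : ∀ {n f f′} → (∀ xs → f xs ≡ f′ xs) → Comp n f → Comp n f′
  respects f≗f′ (computedBy P p) = computedBy P λ xs → subst (Eval P xs) (f≗f′ xs) (p xs)

  zeroC : ∀ {n} → Comp n (λ _ → 0)
  zeroC = computedBy zer λ _ → ev-zer

  succC : Comp 1 (λ v → suc (head v))
  succC = computedBy succ λ { (x ∷ []) → ev-succ }

  projC : ∀ {n} (i : Fin n) → Comp n (λ xs → lookup xs i)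
  projC i = computedBy (proj i) λ _ → ev-proj i

  programs : ∀ {m n} {gs : Vec (Vec ℕ n → ℕ) m} → All (Comp n) gs → Vec (PR n) m
  programs []       = []
  programs (c ∷ cs) = program c ∷ programs cs

  evalAll : ∀ {m n} {gs : Vec (Vec ℕ n → ℕ) m} (cs : All (Comp n) gs) xs →
            EvalAll (programs cs) xs (map (λ g → g xs) gs)
  evalAll []       xs = ev-[]
  evalAll (c ∷ cs) xs = ev-∷ (correct c xs) (evalAll cs xs)

  composeC : ∀ {m n f} {gs : Vec (Vec ℕ n → ℕ) m} → Comp m f → All (Comp n) gs →
             Comp n (λ xs → f (map (λ g → g xs) gs))
  composeC (computedBy P p) cs = computedBy (comp P (programs cs)) λ xs → ev-comp (evalAll cs xs) (p _)

  recursionC : ∀ {n g h} → Comp n g → Comp (suc (suc n)) h → (F : ℕ → Vec ℕ n → ℕ) →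
               (∀ xs → F 0 xs ≡ g xs) → (∀ k xs → F (suc k) xs ≡ h (k ∷ F k xs ∷ xs)) →
               Comp (suc n) (λ v → F (head v) (tail v))
  recursionC (computedBy G p) (computedBy H q) F F-zero F-suc =
    computedBy (rec G H) λ { (k ∷ xs) → evalRec k xs }
    where
    evalRec : ∀ k xs → Eval (rec G H) (k ∷ xs) (F k xs)
    evalRec zero    xs = ev-rec0 (subst (Eval G xs) (sym (F-zero xs)) (p xs))
    evalRec (suc k) xs = ev-recS (evalRec k xs) (subst (Eval H _) (sym (F-suc k xs)) (q _))

  minimisationC : ∀ {n} {F : Vec ℕ (suc n) → ℕ} → Comp (suc n) F → (m : Vec ℕ n → ℕ) →
                  (∀ xs → F (m xs ∷ xs) ≡ 0) → (∀ xs z → z < m xs → F (z ∷ xs) ≢ 0) → Comp n m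
  minimisationC {F = F} (computedBy P p) m m-zero m-least =
    computedBy (mu P) λ xs → ev-mu (subst (Eval P _) (m-zero xs) (p _)) (positiveBelow xs)
    where
    positiveBelow : ∀ xs z → z < m xs → Σ ℕ λ k → Eval P (z ∷ xs) (suc k)
    positiveBelow xs z z<m with F (z ∷ xs) | p (z ∷ xs) | m-least xs z z<m
    ... | zero  | _  | F≢0 = ⊥-elim (F≢0 refl)
    ... | suc k | ev | _   = k , ev

  constC : ∀ {n} k → Comp n (λ _ → k)
  constC zero    = zeroC
  constC (suc k) = composeC succC (constC k ∷ [])

  addC : Comp 2 (λ v → head v + head (tail v))
  addC = recursionC (projC (# 0)) (composeC succC (projC (# 1) ∷ [])) (λ k xs → k + head xs)
                    (λ { (_ ∷ []) → refl }) (λ { _ (_ ∷ []) → refl })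

  mulC : Comp 2 (λ v → head v * head (tail v))
  mulC = recursionC zeroC (composeC addC (projC (# 2) ∷ projC (# 1) ∷ []))
                    (λ k xs → k * head xs) (λ { (_ ∷ []) → refl }) (λ { _ (_ ∷ []) → refl })

  predC : Comp 1 (λ v → head v ∸ 1)
  predC = recursionC zeroC (projC (# 0)) (λ k _ → k ∸ 1) (λ { [] → refl }) (λ { _ [] → refl })

  monusC : Comp 2 (λ v → head v ∸ head (tail v))
  monusC = respects (λ { (x ∷ y ∷ []) → refl })
    (composeC subtractFrom (projC (# 1) ∷ projC (# 0) ∷ []))
    where
    subtractFrom : Comp 2 (λ v → head (tail v) ∸ head v)
    subtractFrom = recursionC (projC (# 0)) (composeC predC (projC (# 1) ∷ [])) (λ k xs → head xs ∸ k)
      (λ { (_ ∷ []) → refl })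
      (λ { k (x ∷ []) → trans (cong (x ∸_) (+-comm 1 k)) (sym (∸-+-assoc x k 1)) })

  pow2C : Comp 1 (λ v → 2 ^ head v)
  pow2C = recursionC (constC 1) (composeC mulC (constC 2 ∷ projC (# 1) ∷ []))
                     (λ k _ → 2 ^ k) (λ { [] → refl }) (λ { _ [] → refl })

module BinaryDigits where

  open Programs
  open import Data.Nat using (ℕ; zero; suc; _+_; _∸_; _<_; z≤n; s≤s; _/_; _%_)
  open import Data.Nat.Properties using (+-comm; +-assoc; ≤-<-trans; n≮0)
  open import Data.Nat.DivMod using ([m+n]%n≡m%n; m/n≡1+[m∸n]/n; m%n<n; m/n<m)
  open import Data.Bool using (Bool; true; false)
  open import Data.Fin using (#_)
  open import Data.Vec using ([]; _∷_; head; tail)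
  open import Data.Vec.Relation.Unary.All using ([]; _∷_)
  open import Data.Sum using (_⊎_; inj₁; inj₂)
  open import Data.Empty using (⊥-elim)
  open import Relation.Binary.PropositionalEquality using (_≡_; refl; sym; trans; cong)
  open Relation.Binary.PropositionalEquality.≡-Reasoning

  bitValue : Bool → ℕ
  bitValue false = 0
  bitValue true  = 1

  parity : ℕ → ℕ
  parity zero    = 0
  parity (suc n) = 1 ∸ parity n

  half : ℕ → ℕ
  half zero    = 0
  half (suc n) = half n + parity n

  parity-isBit : ∀ n → parity n ≡ 0 ⊎ parity n ≡ 1
  parity-isBit zero = inj₁ refl
  parity-isBit (suc n) with parity n | parity-isBit n
  ... | _ | inj₁ refl = inj₂ refl
  ... | _ | inj₂ refl = inj₁ refl

  parity-complement : ∀ n → parity n + parity (suc n) ≡ 1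
  parity-complement n with parity n | parity-isBit n
  ... | _ | inj₁ refl = refl
  ... | _ | inj₂ refl = refl

  parity-suc-suc : ∀ n → parity (suc (suc n)) ≡ parity n
  parity-suc-suc n with parity n | parity-isBit n
  ... | _ | inj₁ refl = refl
  ... | _ | inj₂ refl = refl

  half-suc-suc : ∀ n → half (suc (suc n)) ≡ suc (half n)
  half-suc-suc n = begin
    half n + parity n + parity (suc n)   ≡⟨ +-assoc (half n) (parity n) (parity (suc n)) ⟩
    half n + (parity n + parity (suc n)) ≡⟨ cong (half n +_) (parity-complement n) ⟩
    half n + 1                           ≡⟨ +-comm (half n) 1 ⟩
    suc (half n)                         ∎

  parity≡%2 : ∀ n → parity n ≡ n % 2
  parity≡%2 zero          = refl
  parity≡%2 (suc zero)    = refl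
  parity≡%2 (suc (suc n)) = begin
    parity (suc (suc n)) ≡⟨ parity-suc-suc n ⟩
    parity n             ≡⟨ parity≡%2 n ⟩
    n % 2                ≡⟨ sym ([m+n]%n≡m%n n 2) ⟩
    (n + 2) % 2          ≡⟨ cong (_% 2) (+-comm n 2) ⟩
    suc (suc n) % 2      ∎

  half≡/2 : ∀ n → half n ≡ n / 2
  half≡/2 zero          = refl
  half≡/2 (suc zero)    = refl
  half≡/2 (suc (suc n)) = begin
    half (suc (suc n)) ≡⟨ half-suc-suc n ⟩
    suc (half n)       ≡⟨ cong suc (half≡/2 n) ⟩
    suc (n / 2)        ≡⟨ sym (m/n≡1+[m∸n]/n {suc (suc n)} {2} (s≤s (s≤s z≤n))) ⟩
    suc (suc n) / 2    ∎

  halves : ℕ → ℕ → ℕ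
  halves zero    a = a
  halves (suc x) a = half (halves x a)

  halves-half : ∀ x a → halves x (half a) ≡ half (halves x a)
  halves-half zero    a = refl
  halves-half (suc x) a = cong half (halves-half x a)

  bitValue-bit : ∀ a x → bitValue (bit a x) ≡ parity (halves x a)
  bitValue-bit a zero = trans (lowestDigit a) (sym (parity≡%2 a))
    where
    lowestDigit : ∀ a → bitValue (bit a 0) ≡ a % 2
    lowestDigit a with a % 2 | m%n<n a 2
    ... | 0 | _ = refl
    ... | 1 | _ = refl
    ... | suc (suc _) | s≤s (s≤s ())
  bitValue-bit a (suc x) = begin
    bitValue (bit (a / 2) x)     ≡⟨ bitValue-bit (a / 2) x ⟩
    parity (halves x (a / 2))    ≡⟨ cong (λ b → parity (halves x b)) (sym (half≡/2 a)) ⟩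
    parity (halves x (half a))   ≡⟨ cong parity (halves-half x a) ⟩
    parity (halves (suc x) a)    ∎

  bitC : Comp 2 (λ v → bitValue (bit (head (tail v)) (head v)))
  bitC = respects (λ { (x ∷ a ∷ []) → sym (bitValue-bit a x) })
    (composeC parityC (composeC halvesC (projC (# 0) ∷ projC (# 1) ∷ []) ∷ []))
    where
    parityC : Comp 1 (λ v → parity (head v))
    parityC = recursionC zeroC (composeC monusC (constC 1 ∷ projC (# 1) ∷ [])) (λ k _ → parity k)
                         (λ { [] → refl }) (λ { _ [] → refl })
    halfC : Comp 1 (λ v → half (head v))
    halfC = recursionC zeroC (composeC addC (projC (# 1) ∷ composeC parityC (projC (# 0) ∷ []) ∷ []))
                       (λ k _ → half k) (λ { [] → refl }) (λ { _ [] → refl })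
    halvesC : Comp 2 (λ v → halves (head v) (head (tail v)))
    halvesC = recursionC (projC (# 0)) (composeC halfC (projC (# 1) ∷ []))
                         (λ x xs → halves x (head xs)) (λ { (_ ∷ []) → refl }) (λ { _ (_ ∷ []) → refl })

  bit-true⇒< : ∀ a y → bit a y ≡ true → y < a
  bit-true⇒< zero    zero    ()
  bit-true⇒< (suc a) zero    _ = s≤s z≤n
  bit-true⇒< zero    (suc y) d = ⊥-elim (n≮0 (bit-true⇒< zero y d))
  bit-true⇒< (suc a) (suc y) d = ≤-<-trans (bit-true⇒< (suc a / 2) y d) (m/n<m (suc a) 2 (s≤s (s≤s z≤n)))

module PrefixCodes where

  open Programs
  open BinaryDigits
  open import Data.Nat using (ℕ; zero; suc; _+_; _*_; _^_; _<_; z≤n; s≤s)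
  open import Data.Nat.Properties using (+-assoc; *-assoc; *-distribˡ-+)
  open import Data.Bool using (Bool; true; false)
  open import Data.List using (List; []; _∷_; applyUpTo)
  open import Data.Fin using (#_)
  open import Data.Vec using ([]; _∷_; head; tail)
  open import Data.Vec.Relation.Unary.All using ([]; _∷_)
  open import Data.Product using (_,_)
  open import Relation.Binary.PropositionalEquality using (_≡_; refl; sym; cong; cong₂)
  open Relation.Binary.PropositionalEquality.≡-Reasoning

  encStr-∷ : ∀ b w → encStr (b ∷ w) ≡ suc (bitValue b) + 2 * encStr w
  encStr-∷ false w = refl
  encStr-∷ true  w = refl

  encStr-applyUpTo-suc : ∀ (f : ℕ → Bool) L →
    encStr (applyUpTo f (suc L)) ≡ encStr (applyUpTo f L) + 2 ^ L * suc (bitValue (f L))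
  encStr-applyUpTo-suc f zero with f 0
  ... | false = refl
  ... | true  = refl
  encStr-applyUpTo-suc f (suc L) = begin
    encStr (f 0 ∷ applyUpTo f′ (suc L))
      ≡⟨ encStr-∷ (f 0) _ ⟩
    head′ + 2 * encStr (applyUpTo f′ (suc L))
      ≡⟨ cong (λ e → head′ + 2 * e) (encStr-applyUpTo-suc f′ L) ⟩
    head′ + 2 * (rest + 2 ^ L * new)
      ≡⟨ cong (head′ +_) (*-distribˡ-+ 2 rest (2 ^ L * new)) ⟩
    head′ + (2 * rest + 2 * (2 ^ L * new))
      ≡⟨ sym (+-assoc head′ (2 * rest) _) ⟩
    (head′ + 2 * rest) + 2 * (2 ^ L * new)
      ≡⟨ cong₂ _+_ (sym (encStr-∷ (f 0) _)) (sym (*-assoc 2 (2 ^ L) new)) ⟩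
    encStr (applyUpTo f (suc L)) + 2 ^ suc L * new
      ∎
    where
    f′ : ℕ → Bool
    f′ j = f (suc j)
    head′ rest new : ℕ
    head′ = suc (bitValue (f 0))
    rest  = encStr (applyUpTo f′ L)
    new   = suc (bitValue (f (suc L)))

  -- (L, a) ↦ code of the string of the first L binary digits of a; the recursion
  -- step is (L, e, a) ↦ e + 2ᴸ · (digit L of a + 1).
  prefixCodeC : Comp 2 (λ v → encStr (applyUpTo (bit (head (tail v))) (head v)))
  prefixCodeC = recursionC zeroC
    (composeC addC (projC (# 1) ∷ composeC mulC (composeC pow2C (projC (# 0) ∷ [])
      ∷ composeC succC (composeC bitC (projC (# 0) ∷ projC (# 2) ∷ []) ∷ []) ∷ []) ∷ []))
    (λ L xs → encStr (applyUpTo (bit (head xs)) L))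
    (λ { (_ ∷ []) → refl })
    (λ { L (a ∷ []) → encStr-applyUpTo-suc (bit a) L })

  applyUpTo-isPrefix : ∀ (f : ℕ → Bool) L Z → (∀ j → j < L → f j ≡ Z j) → IsPrefix (applyUpTo f L) Z
  applyUpTo-isPrefix f zero    Z agree = _
  applyUpTo-isPrefix f (suc L) Z agree =
    agree 0 (s≤s z≤n) ,
    applyUpTo-isPrefix (λ j → f (suc j)) L (λ j → Z (suc j)) (λ j j<L → agree (suc j) (s≤s j<L))

module Search where

  open import Data.Nat using (ℕ; zero; suc; _<_; z≤n; s≤s)
  open import Data.Bool using (true; false)
  open import Data.Maybe using (just; nothing)
  open import Data.Product using (Σ; _×_; _,_)
  open import Data.Sum using (_⊎_; inj₁; inj₂)
  open import Relation.Nullary using (contradiction)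
  open import Relation.Binary.PropositionalEquality using (_≡_; _≢_; refl; sym; trans)

  -- Bounded search: the least z < B with f z ≡ 0, or B if there is none.
  leastZero : (ℕ → ℕ) → ℕ → ℕ
  leastZero f zero    = 0
  leastZero f (suc B) with f 0
  ... | zero  = 0
  ... | suc _ = suc (leastZero (λ z → f (suc z)) B)

  leastZero-isZero : ∀ (f : ℕ → ℕ) B → f B ≡ 0 → f (leastZero f B) ≡ 0
  leastZero-isZero f zero    fB≡0 = fB≡0
  leastZero-isZero f (suc B) fB≡0 with f 0 in f0≡
  ... | zero  = f0≡
  ... | suc _ = leastZero-isZero (λ z → f (suc z)) B fB≡0

  leastZero-least : ∀ (f : ℕ → ℕ) B z → z < leastZero f B → f z ≢ 0
  leastZero-least f (suc B) z       z<     with f 0 in f0≡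
  leastZero-least f (suc B) zero    z<     | suc _ = λ f0≡0 → contradiction (trans (sym f0≡) f0≡0) λ ()
  leastZero-least f (suc B) (suc z) (s≤s z<) | suc _ = leastZero-least (λ z → f (suc z)) B z z<

  search-just : ∀ b p {x} → search b p ≡ just x → p x ≡ true × x < b × (∀ z → z < x → p z ≡ false)
  search-just (suc b) p eq with p 0 in p0≡
  search-just (suc b) p refl | true = p0≡ , s≤s z≤n , λ _ ()
  ... | false with search b (λ x → p (suc x)) in found
  search-just (suc b) p refl | false | just x with search-just b (λ x → p (suc x)) found
  ... | px , x<b , below = px , s≤s x<b , λ { zero _ → p0≡ ; (suc z) (s≤s z<x) → below z z<x }

  search-nothing : ∀ b p → search b p ≡ nothing → ∀ z → z < b → p z ≡ false
  search-nothing (suc b) p eq z z<b with p 0 in p0≡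
  search-nothing (suc b) p () z z<b | true
  ... | false with search b (λ x → p (suc x)) in found
  search-nothing (suc b) p () z z<b | false | just _
  search-nothing (suc b) p refl zero    z<b       | false | nothing = p0≡
  search-nothing (suc b) p refl (suc z) (s≤s z<b) | false | nothing =
    search-nothing b (λ x → p (suc x)) found z z<b

  firstDiff-cases : ∀ a b → (Σ ℕ λ x → firstDiff a b ≡ just x) ⊎ firstDiff a b ≡ nothing
  firstDiff-cases a b with firstDiff a b
  ... | just x  = inj₁ (x , refl)
  ... | nothing = inj₂ refl

module ChangePoint where

  open Programs
  open BinaryDigits
  open Search
  open import Data.Nat using (ℕ; suc; _+_; _*_; _∸_; _<_; _≤_; s≤s)
  open import Data.Nat.Properties
    using (+-identityʳ; *-zeroʳ; n∸n≡0; m∸n≡0⇒m≤n; <-cmp; <-irrefl; <-trans; ≤-trans; <-≤-trans; ≤-<-trans;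
           m≤m+n; m≤n+m; m≤n⇒m≤1+n)
  open import Data.Bool using (Bool; true; false)
  open import Data.Maybe using (just; nothing)
  open import Data.Fin using (Fin; #_)
  open import Data.Vec using ([]; _∷_; lookup)
  open import Data.Vec.Relation.Unary.All using ([]; _∷_)
  open import Data.Product using (_,_)
  open import Data.Sum using (_⊎_; inj₁; inj₂)
  open import Relation.Nullary using (contradiction)
  open import Relation.Binary using (tri<; tri≈; tri>)
  open import Relation.Binary.PropositionalEquality using (_≡_; _≢_; refl; sym; trans; cong)

  differs : ℕ → ℕ → ℕ → Bool
  differs a b y = differ (bit a y) (bit b y)

  agreeValue : Bool → Bool → ℕ
  agreeValue true  true  = 1
  agreeValue false false = 1
  agreeValue _     _     = 0

  agreeValue-arith : ∀ u v → agreeValue u v ≡ 1 ∸ ((bitValue u ∸ bitValue v) + (bitValue v ∸ bitValue u))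
  agreeValue-arith true  true  = refl
  agreeValue-arith true  false = refl
  agreeValue-arith false true  = refl
  agreeValue-arith false false = refl

  agreeValue-zero : ∀ u v m → agreeValue u v * m ≡ 0 → differ u v ≡ true ⊎ m ≡ 0
  agreeValue-zero true  true  m eq = inj₂ (trans (sym (+-identityʳ m)) eq)
  agreeValue-zero false false m eq = inj₂ (trans (sym (+-identityʳ m)) eq)
  agreeValue-zero true  false m eq = inj₁ refl
  agreeValue-zero false true  m eq = inj₁ refl

  agreeValue-nonzero : ∀ u v m → agreeValue u v * m ≢ 0 → u ≡ v
  agreeValue-nonzero true  true  m _  = refl
  agreeValue-nonzero false false m _  = refl
  agreeValue-nonzero true  false m ≢0 = contradiction refl ≢0
  agreeValue-nonzero false true  m ≢0 = contradiction refl ≢0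

  equal-nonDiffer : ∀ {u v} → u ≡ v → differ u v ≢ true
  equal-nonDiffer {true}  refl ()
  equal-nonDiffer {false} refl ()

  differ-bound : ∀ a b y → differs a b y ≡ true → y < suc (a + b)
  differ-bound a b y d with bit a y in ay | bit b y in by
  ... | true  | false = m≤n⇒m≤1+n (<-≤-trans (bit-true⇒< a y ay) (m≤m+n a b))
  ... | false | true  = m≤n⇒m≤1+n (<-≤-trans (bit-true⇒< b y by) (m≤n+m b a))

  -- The change point of D_a against D_b at stage s: the least y at which they differ,
  -- searched up to a bound beyond all differences and beyond s.
  searchBound : ℕ → ℕ → ℕ → ℕ
  searchBound a b s = suc (a + b + s)

  stopAt : ℕ → ℕ → ℕ → ℕ → ℕ
  stopAt a b s y = agreeValue (bit a y) (bit b y) * (searchBound a b s ∸ y)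

  stopAt-zero : ∀ a b s y → stopAt a b s y ≡ 0 → differs a b y ≡ true ⊎ searchBound a b s ≤ y
  stopAt-zero a b s y stop with agreeValue-zero (bit a y) (bit b y) (searchBound a b s ∸ y) stop
  ... | inj₁ differ-y  = inj₁ differ-y
  ... | inj₂ exhausted = inj₂ (m∸n≡0⇒m≤n exhausted)

  stopAt-nonzero : ∀ a b s y → stopAt a b s y ≢ 0 → bit a y ≡ bit b y
  stopAt-nonzero a b s y = agreeValue-nonzero (bit a y) (bit b y) (searchBound a b s ∸ y)

  changePoint : ℕ → ℕ → ℕ → ℕ
  changePoint a b s = leastZero (stopAt a b s) (searchBound a b s)

  -- The search stops at the change point, as the search bound itself stops.
  changePoint-stops : ∀ a b s → stopAt a b s (changePoint a b s) ≡ 0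
  changePoint-stops a b s = leastZero-isZero (stopAt a b s) (searchBound a b s) stopsAtBound
    where
    stopsAtBound : stopAt a b s (searchBound a b s) ≡ 0
    stopsAtBound = trans (cong (agreement *_) (n∸n≡0 (searchBound a b s))) (*-zeroʳ agreement)
      where
      agreement : ℕ
      agreement = agreeValue (bit a (searchBound a b s)) (bit b (searchBound a b s))

  changePoint-agree : ∀ a b s z → z < changePoint a b s → bit a z ≡ bit b z
  changePoint-agree a b s z z<cp =
    stopAt-nonzero a b s z (leastZero-least (stopAt a b s) (searchBound a b s) z z<cp)

  changePoint-firstDiff : ∀ a b s x → firstDiff a b ≡ just x → changePoint a b s ≡ x
  changePoint-firstDiff a b s x found with search-just (suc (a + b)) (differs a b) found
  ... | differ-x , x<bound , agree-below with <-cmp (changePoint a b s) x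
  ... | tri≈ _ cp≡x _ = cp≡x
  ... | tri> _ _ x<cp = contradiction differ-x (equal-nonDiffer (changePoint-agree a b s x x<cp))
  ... | tri< cp<x _ _ with stopAt-zero a b s (changePoint a b s) (changePoint-stops a b s)
  ...   | inj₁ differ-cp = contradiction (trans (sym differ-cp) (agree-below (changePoint a b s) cp<x)) λ ()
  ...   | inj₂ exhausted = contradiction (≤-<-trans exhausted
                             (<-trans cp<x (<-≤-trans x<bound (s≤s (m≤m+n (a + b) s))))) (<-irrefl refl)

  changePoint-noDiff : ∀ a b s → firstDiff a b ≡ nothing → s ≤ changePoint a b s
  changePoint-noDiff a b s none with stopAt-zero a b s (changePoint a b s) (changePoint-stops a b s)
  ... | inj₁ differ-cp = contradiction (trans (sym differ-cp) agree-cp) λ ()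
    where
    -- the search of firstDiff covers the change point and found no difference there
    agree-cp : differs a b (changePoint a b s) ≡ false
    agree-cp = search-nothing (suc (a + b)) (differs a b) none (changePoint a b s)
                              (differ-bound a b (changePoint a b s) differ-cp)
  ... | inj₂ exhausted = ≤-trans (m≤n⇒m≤1+n (m≤n+m s (a + b))) exhausted

  changePointC : Comp 3 (λ v → changePoint (lookup v (# 0)) (lookup v (# 1)) (lookup v (# 2)))
  changePointC = minimisationC stopC (λ v → changePoint (lookup v (# 0)) (lookup v (# 1)) (lookup v (# 2)))
    (λ { (a ∷ b ∷ s ∷ []) → changePoint-stops a b s })
    (λ { (a ∷ b ∷ s ∷ []) z z<cp → leastZero-least (stopAt a b s) (searchBound a b s) z z<cp })
    where
    -- Inputs (y, a, b, s); each component is read off by a projection.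
    digitC : (i : Fin 4) → Comp 4 (λ v → bitValue (bit (lookup v i) (lookup v (# 0))))
    digitC i = composeC bitC (projC (# 0) ∷ projC i ∷ [])
    distanceC : (i j : Fin 4) → Comp 4 (λ v → bitValue (bit (lookup v i) (lookup v (# 0)))
                                            ∸ bitValue (bit (lookup v j) (lookup v (# 0))))
    distanceC i j = composeC monusC (digitC i ∷ digitC j ∷ [])
    agreeC : Comp 4 (λ v → agreeValue (bit (lookup v (# 1)) (lookup v (# 0)))
                                      (bit (lookup v (# 2)) (lookup v (# 0))))
    agreeC = respects (λ v → sym (agreeValue-arith _ _))
      (composeC monusC (constC 1 ∷ composeC addC (distanceC (# 1) (# 2) ∷ distanceC (# 2) (# 1) ∷ []) ∷ []))
    boundGapC : Comp 4 (λ v → searchBound (lookup v (# 1)) (lookup v (# 2)) (lookup v (# 3)) ∸ lookup v (# 0))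
    boundGapC = composeC monusC (composeC succC (composeC addC (composeC addC (projC (# 1) ∷ projC (# 2) ∷ [])
                  ∷ projC (# 3) ∷ []) ∷ []) ∷ projC (# 0) ∷ [])
    stopC : Comp 4 (λ { (y ∷ a ∷ b ∷ s ∷ []) → stopAt a b s y })
    stopC = respects (λ { (y ∷ a ∷ b ∷ s ∷ []) → refl }) (composeC mulC (agreeC ∷ boundGapC ∷ []))

module Settling where

  open Programs
  open PrefixCodes
  open ChangePoint
  open import Data.Nat using (ℕ; zero; suc; _+_; _∸_; _<_; _≤_; _<?_; z≤n; s≤s)
  open import Data.Nat.Properties
    using (≤-refl; ≤-trans; <-≤-trans; <⇒≱; ≮⇒≥; m≤n⇒m<n∨m≡n; m≤n⇒m≤1+n; m≤m+n; m≤n+m)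
  open import Data.Bool using (Bool)
  open import Data.List using (List; applyUpTo)
  open import Data.Fin using (#_)
  open import Data.Vec using ([]; _∷_; head)
  open import Data.Vec.Relation.Unary.All using ([]; _∷_)
  open import Data.Product using (Σ; _×_; _,_)
  open import Data.Sum using (inj₁; inj₂)
  open import Relation.Nullary using (¬_; yes; no; contradiction)
  open import Relation.Unary using (Decidable)
  open import Relation.Binary.PropositionalEquality using (_≡_; refl; sym; trans)

  commonSettling : ∀ (A : ℕ → ℕ → Bool) (Z : ℕ → Bool) → (∀ x → Σ ℕ λ s₀ → ∀ s → s₀ ≤ s → A s x ≡ Z x) →
                   ∀ L → Σ ℕ λ S → ∀ x → x < L → ∀ s → S ≤ s → A s x ≡ Z x
  commonSettling A Z converges zero    = 0 , λ _ ()
  commonSettling A Z converges (suc L) with commonSettling A Z converges L | converges L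
  ... | S , settled | s₀ , settledL = S + s₀ , settledBelow
    where
    settledBelow : ∀ x → x < suc L → ∀ s → S + s₀ ≤ s → A s x ≡ Z x
    settledBelow x (s≤s x≤L) s S+s₀≤s with m≤n⇒m<n∨m≡n x≤L
    ... | inj₁ x<L  = settled x x<L s (≤-trans (m≤m+n S s₀) S+s₀≤s)
    ... | inj₂ refl = settledL s (≤-trans (m≤n+m s₀ S) S+s₀≤s)

  lastWitness : ∀ {P : ℕ → Set} → Decidable P → ∀ {t} → P t → ∀ u → t ≤ u →
                Σ ℕ λ i → t ≤ i × i ≤ u × P i × (∀ k → i < k → k ≤ u → ¬ P k)
  lastWitness P? Pt zero z≤n = 0 , z≤n , z≤n , Pt , λ k 0<k k≤0 → contradiction k≤0 (<⇒≱ 0<k)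
  lastWitness {P} P? Pt (suc u) t≤su with P? (suc u)
  ... | yes Psu = suc u , t≤su , ≤-refl , Psu , λ k su<k k≤su → contradiction k≤su (<⇒≱ su<k)
  ... | no ¬Psu with m≤n⇒m<n∨m≡n t≤su
  ...   | inj₂ refl = contradiction Pt ¬Psu
  ...   | inj₁ (s≤s t≤u) with lastWitness P? Pt u t≤u
  ...     | i , t≤i , i≤u , Pi , lastBelow = i , t≤i , m≤n⇒m≤1+n i≤u , Pi , later
    where
    later : ∀ k → i < k → k ≤ suc u → ¬ P k
    later k i<k k≤su with m≤n⇒m<n∨m≡n k≤su
    ... | inj₁ (s≤s k≤u) = lastBelow k i<k k≤u
    ... | inj₂ refl      = ¬Psu

  module Stages (g : ℕ → ℕ) where

    -- Position of the first change at stage s; at least s if nothing changes.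
    Y : ℕ → ℕ
    Y s = changePoint (g s) (g (s ∸ 1)) s

    σ : ℕ → List Bool
    σ s = applyUpTo (bit (g s)) (suc (Y s))

    σ-computable : Computable₁ g → ComputableStrSeq σ
    σ-computable g-computable =
      toComputable₁ (composeC prefixCodeC (composeC succC (YC ∷ []) ∷ gC ∷ []))
      where
      gC : Comp 1 (λ v → g (head v))
      gC = fromComputable₁ g-computable
      YC : Comp 1 (λ v → Y (head v))
      YC = respects (λ { (s ∷ []) → refl })
        (composeC changePointC (gC ∷ composeC gC (composeC predC (projC (# 0) ∷ []) ∷ []) ∷ projC (# 0) ∷ []))

    stableBetween : ∀ {L i} u → i ≤ u → (∀ k → i < k → k ≤ u → L ≤ Y k) →
                    ∀ x → x < L → bit (g i) x ≡ bit (g u) x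
    stableBetween zero z≤n stable x x<L = refl
    stableBetween (suc u) i≤su stable x x<L with m≤n⇒m<n∨m≡n i≤su
    ... | inj₂ refl      = refl
    ... | inj₁ (s≤s i≤u) = trans
      (stableBetween u i≤u (λ k i<k k≤u → stable k i<k (m≤n⇒m≤1+n k≤u)) x x<L)
      (sym (changePoint-agree (g (suc u)) (g u) (suc u) x (<-≤-trans x<L (stable (suc u) (s≤s i≤u) ≤-refl))))

    -- If the approximation converges to Z, then after every stage t some σ i is a
    -- prefix of Z: take the last stage i in [t, u] changing a digit below Y t + 1,
    -- where u is late enough for these digits to have settled.
    prefixAfter : ∀ Z → (∀ x → Σ ℕ λ s₀ → ∀ s → s₀ ≤ s → bit (g s) x ≡ Z x) →
                  ∀ t → Σ ℕ λ i → t ≤ i × IsPrefix (σ i) Z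
    prefixAfter Z converges t with commonSettling (λ s → bit (g s)) Z converges (suc (Y t))
    ... | S , settled with lastWitness (λ k → Y k <? suc (Y t)) ≤-refl (t + S) (m≤m+n t S)
    ... | i , t≤i , i≤u , Yi<L , last = i , t≤i , applyUpTo-isPrefix (bit (g i)) (suc (Y i)) Z agreesWithZ
      where
      agreesWithZ : ∀ j → j < suc (Y i) → bit (g i) j ≡ Z j
      agreesWithZ j j<Yi = trans
        (stableBetween (t + S) i≤u (λ k i<k k≤u → ≮⇒≥ (last k i<k k≤u)) j (<-≤-trans j<Yi Yi<L))
        (settled j (<-≤-trans j<Yi Yi<L) (t + S) (m≤n+m S t))

module Weights where

  open Search
  open ChangePoint
  open Settling
  open import Data.Nat as ℕ using (ℕ; zero; suc; _∸_; z≤n; s≤s; _≤′_; ≤′-refl; ≤′-step)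
  open import Data.Nat.Properties using (≤⇒≤′)
  open import Data.Rational using (ℚ; 0ℚ; 1ℚ; ½; _+_; _≤_; _≤?_)
  open import Data.Rational.Properties
    using (≤-refl; ≤-trans; +-assoc; +-mono-≤; +-monoˡ-≤; +-monoʳ-≤; +-identityˡ; +-identityʳ;
           *-monoˡ-≤-nonNeg; *-distribʳ-+; *-identityˡ; +-0-commutativeMonoid; module ≤-Reasoning)
  open import Algebra.Bundles using (CommutativeMonoid)
  open import Algebra.Properties.CommutativeSemigroup
    (CommutativeMonoid.commutativeSemigroup +-0-commutativeMonoid) using (x∙yz≈xz∙y; xy∙z≈xz∙y)
  open import Data.List using (length)
  open import Data.List.Properties using (length-applyUpTo)
  open import Data.Maybe using (just; nothing)
  open import Data.Product using (_,_)
  open import Data.Sum using (inj₁; inj₂)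
  open import Data.Unit using (tt)
  open import Relation.Nullary.Decidable using (toWitness)
  open import Relation.Binary.PropositionalEquality using (_≡_; refl; sym; trans; cong)

  2^-nonNeg : ∀ k → 0ℚ ≤ 2^- k
  2^-nonNeg zero    = toWitness {a? = 0ℚ ≤? 1ℚ} tt
  2^-nonNeg (suc k) = *-monoˡ-≤-nonNeg ½ (2^-nonNeg k)

  2^-halves : ∀ k → 2^- (suc k) + 2^- (suc k) ≡ 2^- k
  2^-halves k = trans (sym (*-distribʳ-+ (2^- k) ½ ½)) (*-identityˡ (2^- k))

  2^-suc≤ : ∀ k → 2^- (suc k) ≤ 2^- k
  2^-suc≤ k = begin
    2^- (suc k)                 ≡⟨ sym (+-identityʳ (2^- (suc k))) ⟩
    2^- (suc k) + 0ℚ            ≤⟨ +-monoʳ-≤ (2^- (suc k)) (2^-nonNeg (suc k)) ⟩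
    2^- (suc k) + 2^- (suc k)   ≡⟨ 2^-halves k ⟩
    2^- k                       ∎
    where open ≤-Reasoning

  2^-antitone : ∀ {k l} → k ℕ.≤ l → 2^- l ≤ 2^- k
  2^-antitone k≤l = fromStepwise (≤⇒≤′ k≤l)
    where
    fromStepwise : ∀ {k l} → k ≤′ l → 2^- l ≤ 2^- k
    fromStepwise ≤′-refl           = ≤-refl
    fromStepwise (≤′-step {l} k≤′l) = ≤-trans (2^-suc≤ l) (fromStepwise k≤′l)

  module CostBoundsWeight (c : ℕ → ℕ → ℚ) (g : ℕ → ℕ) (c-large : ∀ x s → 2^- x ≤ c x s) where
    open Stages g

    stageCost-change : ∀ s x → firstDiff (g s) (g (s ∸ 1)) ≡ just x → stageCost c g s ≡ c x s
    stageCost-change s x found with firstDiff (g s) (g (s ∸ 1))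
    stageCost-change s x refl | just .x = refl

    stageCost-noChange : ∀ s → firstDiff (g s) (g (s ∸ 1)) ≡ nothing → stageCost c g s ≡ 0ℚ
    stageCost-noChange s none with firstDiff (g s) (g (s ∸ 1))
    stageCost-noChange s refl | nothing = refl

    weight-σ : ∀ s → 2^- (length (σ s)) ≡ 2^- (suc (Y s))
    weight-σ s = cong 2^-_ (length-applyUpTo (bit (g s)) (suc (Y s)))

    -- A change at x at stage s makes σ s of weight 2⁻⁽ˣ⁺¹⁾ ≤ c(x, s); no change makes
    -- σ s at least s + 1 long.  Either way the stage is paid for up to 2⁻⁽ˢ⁺¹⁾.
    stageWeight : ∀ s → 2^- (suc (Y s)) + 2^- (suc s) ≤ stageCost c g s + 2^- s
    stageWeight s with firstDiff-cases (g s) (g (s ∸ 1))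
    ... | inj₁ (x , found) = begin
      2^- (suc (Y s)) + 2^- (suc s)
        ≡⟨ cong (λ y → 2^- (suc y) + 2^- (suc s)) (changePoint-firstDiff (g s) (g (s ∸ 1)) s x found) ⟩
      2^- (suc x) + 2^- (suc s)
        ≤⟨ +-mono-≤ (≤-trans (2^-suc≤ x) (c-large x s)) (2^-suc≤ s) ⟩
      c x s + 2^- s
        ≡⟨ cong (_+ 2^- s) (sym (stageCost-change s x found)) ⟩
      stageCost c g s + 2^- s
        ∎
      where open ≤-Reasoning
    ... | inj₂ found = begin
      2^- (suc (Y s)) + 2^- (suc s)
        ≤⟨ +-monoˡ-≤ (2^- (suc s)) (2^-antitone (s≤s (changePoint-noDiff (g s) (g (s ∸ 1)) s found))) ⟩
      2^- (suc s) + 2^- (suc s)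
        ≡⟨ 2^-halves s ⟩
      2^- s
        ≡⟨ sym (+-identityˡ (2^- s)) ⟩
      0ℚ + 2^- s
        ≡⟨ cong (_+ 2^- s) (sym (stageCost-noChange s found)) ⟩
      stageCost c g s + 2^- s
        ∎
      where open ≤-Reasoning

    -- Summing the stage estimates, the tails 2⁻⁽ⁿ⁺¹⁾ telescope.
    weight-telescope : ∀ n → weightUpTo σ (suc n) + 2^- (suc n) ≤ costUpTo c g n + 1ℚ
    weight-telescope zero = begin
      (0ℚ + 2^- (length (σ 0))) + ½
        ≡⟨ cong (λ w → (0ℚ + w) + ½) (weight-σ 0) ⟩
      (0ℚ + 2^- (suc (Y 0))) + ½
        ≤⟨ +-monoˡ-≤ ½ (+-monoʳ-≤ 0ℚ (2^-antitone {1} {suc (Y 0)} (s≤s z≤n))) ⟩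
      (0ℚ + ½) + ½
        ≡⟨⟩
      0ℚ + 1ℚ
        ∎
      where open ≤-Reasoning
    weight-telescope (suc n) = begin
      (W + 2^- (length (σ s))) + 2^- (suc s)
        ≡⟨ cong (λ w → (W + w) + 2^- (suc s)) (weight-σ s) ⟩
      (W + 2^- (suc (Y s))) + 2^- (suc s)
        ≡⟨ +-assoc W (2^- (suc (Y s))) (2^- (suc s)) ⟩
      W + (2^- (suc (Y s)) + 2^- (suc s))
        ≤⟨ +-monoʳ-≤ W (stageWeight s) ⟩
      W + (stageCost c g s + 2^- s)
        ≡⟨ x∙yz≈xz∙y W (stageCost c g s) (2^- s) ⟩
      (W + 2^- s) + stageCost c g s
        ≤⟨ +-monoˡ-≤ (stageCost c g s) (weight-telescope n) ⟩
      (costUpTo c g n + 1ℚ) + stageCost c g s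
        ≡⟨ xy∙z≈xz∙y (costUpTo c g n) 1ℚ (stageCost c g s) ⟩
      costUpTo c g s + 1ℚ
        ∎
      where
      open ≤-Reasoning
      s : ℕ
      s = suc n
      W : ℚ
      W = weightUpTo σ s

    weight-bounded : ∀ B → (∀ n → costUpTo c g n ≤ B) → ∀ n → weightUpTo σ n ≤ B + 1ℚ
    weight-bounded B cost≤B zero    = +-mono-≤ (cost≤B 0) (2^-nonNeg 0)
    weight-bounded B cost≤B (suc n) = begin
      weightUpTo σ (suc n)                ≡⟨ sym (+-identityʳ (weightUpTo σ (suc n))) ⟩
      weightUpTo σ (suc n) + 0ℚ           ≤⟨ +-monoʳ-≤ (weightUpTo σ (suc n)) (2^-nonNeg (suc n)) ⟩
      weightUpTo σ (suc n) + 2^- (suc n)  ≤⟨ weight-telescope n ⟩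
      costUpTo c g n + 1ℚ                 ≤⟨ +-monoˡ-≤ 1ℚ (cost≤B n) ⟩
      B + 1ℚ                              ∎
      where open ≤-Reasoning

open import Data.Nat using (ℕ)
open import Data.Bool using (Bool)
open import Data.Rational using (ℚ; _≤_; _+_; 1ℚ)
open import Relation.Nullary using (¬_)
open import Data.Product using (_,_)
open Settling using (module Stages)
open Weights using (module CostBoundsWeight)

mainTheorem2 : (c : ℕ → ℕ → ℚ) → IsCostFunction c →
               (∀ x s → 2^- x ≤ c x s) →
               (Z : ℕ → Bool) → Δ⁰₂ Z → MLRandom Z → ¬ Obeys Z c
mainTheorem2 c _ c-large Z _ random (g , (g-computable , converges) , B , cost≤B) =
  let open Stages g
      t , σ-notPrefix = random σ (σ-computable g-computable)
                          (B + 1ℚ , CostBoundsWeight.weight-bounded c g c-large B cost≤B)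
      i , t≤i , σi-prefix = prefixAfter Z converges t
  in σ-notPrefix i t≤i σi-prefix
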